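{- Let $n\ge2$ and let $\lambda$ be a partition with at most $n-1$ positive parts, each positive integer occurring at most twice, with $\lambda_1\le n-1$. Write $\lambda=(\lambda_1,\dots,\lambda_{n+1})$ by appending zeros, and for $1\le i<j\le n+1$ let $\lambda^{(i,j)}$ be the partition obtained by deleting the $i$-th and $j$-th entries. Then: (1) if $\lambda_1=n-1$, $\displaystyle \mathfrak C^n(\lambda)=\sum_{2\le i\le n+1}q^{i-2}\,\mathfrak C^{n-1}(\lambda^{(1,i)})$; (2) if $\lambda_1\le n-2$, $\displaystyle \mathfrak C^n(\lambda)=\sum_{1\le i<j\le n+1}q^{i+j-3}\,\mathfrak C^{n-1}(\lambda^{(i,j)})$.
   Context: For $k\ge1$: grid with $2k$ rows numbered $1,\dots,2k$ from top to bottom and $k$ columns numbered $1,\dots,k$ from left to right; box $(i,j)$ is in row $i$, column $j$. For a partition $\lambda$ (with $\lambda_i=0$ beyond its last part), a Dellac configuration of size $k$ with boundaries $\lambda$ and $\delta_{k-1}=(k-1,\dots,1)$ is a set of $2k$ boxes ("dots") such that each row contains exactly one dot, each column contains exactly two dots, no dot lies in a box $(i,j)$ with $j\le\lambda_i$ (any row $i$), and no dot lies in a box $(i,j)$ with $k+2\le i\le 2k$ and $j\ge 2k+2-i$. An inversion is a pair of dots one of which lies strictly above and strictly to the left of the other. $\mathfrak C^k(\lambda)=\sum_C q^{\mathrm{inv}(C)}$, summed over all such configurations $C$ (it is $0$ if there are none). -}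

module Defs where

open import Data.Nat using (ℕ; zero; suc; _+_; _*_; _∸_; _≤ᵇ_; _<ᵇ_; _≡ᵇ_; _≤_; _<_)
open import Data.Bool using (Bool; true; false; _∧_; not; if_then_else_)
open import Data.List using (List; []; _∷_; map; foldr; length; filterᵇ; concatMap; upTo)
open import Relation.Binary.PropositionalEquality using (_≡_)

-- Polynomials in q with natural-number coefficients, represented by their
-- coefficient function: P d = coefficient of q^d.
Poly : Set
Poly = ℕ → ℕ

zeroP : Poly
zeroP _ = 0

_⊕_ : Poly → Poly → Poly
(P ⊕ Q) d = P d + Q d

ΣP : List Poly → Poly
ΣP = foldr _⊕_ zeroP

q^_·_ : ℕ → Poly → Poly
(q^ a · P) d = if a ≤ᵇ d then P (d ∸ a) else 0

_≈P_ : Poly → Poly → Set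
P ≈P Q = ∀ d → P d ≡ Q d

-- 1-based entry of a list, 0 beyond its end (λ_i = 0 beyond the last part)
entry : List ℕ → ℕ → ℕ
entry []       _             = 0
entry (x ∷ xs) zero          = 0
entry (x ∷ xs) (suc zero)    = x
entry (x ∷ xs) (suc (suc i)) = entry xs (suc i)

range : ℕ → ℕ → List ℕ
range a b = map (a +_) (upTo (suc b ∸ a))

occ : ℕ → List ℕ → ℕ
occ m xs = length (filterᵇ (m ≡ᵇ_) xs)

-- A candidate configuration of size k is a list c of length 2k with entries
-- in [1,k]: c_i (= entry c i) is the column of the unique dot in row i.
-- allConfigs m k = all lists of length m with entries in [1,k].
allConfigs : ℕ → ℕ → List (List ℕ)
allConfigs zero    k = [] ∷ []
allConfigs (suc m) k = concatMap (λ j → map (j ∷_) (allConfigs m k)) (range 1 k)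

allᵇ : {A : Set} → (A → Bool) → List A → Bool
allᵇ p = foldr (λ x b → p x ∧ b) true

-- Dellac conditions with boundaries λ and δ_{k-1}:
--  * each column j ∈ [1,k] contains exactly two dots;
--  * no dot in box (i,j) with j ≤ λ_i, i.e. λ_i < c_i for every row i;
--  * for k+2 ≤ i ≤ 2k no dot in (i,j) with j ≥ 2k+2-i, i.e. c_i + i < 2k+2.
isDellac : ℕ → List ℕ → List ℕ → Bool
isDellac k lam c =
  allᵇ (λ j → occ j c ≡ᵇ 2) (range 1 k) ∧
  (allᵇ (λ i → entry lam i <ᵇ entry c i) (range 1 (2 * k)) ∧
   allᵇ (λ i → (entry c i + i) <ᵇ (2 * k + 2)) (range (k + 2) (2 * k)))

-- inversions: pairs of rows i < i' (dot of row i strictly above) with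
-- c_i < c_{i'} (strictly to the left)
inv : List ℕ → ℕ
inv []       = 0
inv (x ∷ xs) = length (filterᵇ (x <ᵇ_) xs) + inv xs

𝔠 : ℕ → List ℕ → Poly
𝔠 k lam d = length (filterᵇ (λ c → isDellac k lam c ∧ (inv c ≡ᵇ d)) (allConfigs (2 * k) k))

delete2 : ℕ → List ℕ → ℕ → ℕ → List ℕ
delete2 n lam i j = map (entry lam) (filterᵇ (λ r → not (r ≡ᵇ i) ∧ not (r ≡ᵇ j)) (range 1 (n + 1)))

-- In a Dellac configuration of size n the last column holds exactly two dots,
-- in rows i < j. The staircase forbids column n below row n + 1, so j ≤ n + 1,
-- and since every part of λ is at most n - 1 any such pair of rows is allowed.
-- Deleting rows i, j and the last column is then a bijection onto the Dellac
-- configurations of size n - 1 with boundary λ^{(i,j)}, and it removes exactly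
-- i + j - 3 inversions, the dots of the last column being the largest entries.
-- Configurations are encoded as words c_1 … c_{2n} over [1, n]; the bijection
-- appears as the sorting of all words by the positions of the letter n.
-- If λ_1 = n - 1, the first row can only hold a dot of the last column, so
-- every term with i ≥ 2 vanishes.
module Submission where

open import Defs
open import Data.Nat using (ℕ; _+_; _∸_; _≤_; _≥_; _<_)
open import Data.Product using (_×_)
open import Data.List using (List; map; concatMap; length)
open import Data.List.Relation.Unary.All using (All)
open import Data.List.Relation.Unary.Linked using (Linked)
open import Relation.Binary.PropositionalEquality using (_≡_)

open import Data.Bool using (Bool; true; false; _∧_; not; if_then_else_)
open import Data.Bool.Properties using (∧-zeroʳ; ∧-identityʳ; ∧-assoc)
open import Data.List using ([]; _∷_; filterᵇ; applyUpTo; drop; _++_)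
open import Data.List.Properties using (map-upTo)
open import Data.List.Relation.Unary.All using ([]; _∷_)
open import Data.List.Relation.Unary.All.Properties using (drop⁺)
open import Data.List.Relation.Unary.Linked using (_∷_)
open import Data.Nat using (zero; suc; _*_; _≤ᵇ_; _<ᵇ_; _≡ᵇ_; z≤n; s≤s)
open import Data.Nat.Properties
open import Algebra.Properties.CommutativeSemigroup +-commutativeSemigroup using (interchange)
open import Data.Nat.Tactic.RingSolver using (solve-∀)
open import Data.Product using (_,_)
open import Function using (_∘_)
open import Relation.Binary.Definitions using (tri<; tri≈; tri>)
open import Relation.Binary.PropositionalEquality
open import Relation.Nullary using (contradiction; yes; no)

boolToℕ : Bool → ℕ
boolToℕ true  = 1
boolToℕ false = 0

<⇒<ᵇ≡true : ∀ {m n} → m < n → (m <ᵇ n) ≡ true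
<⇒<ᵇ≡true {zero}  {suc n} _       = refl
<⇒<ᵇ≡true {suc m} {suc n} (s≤s p) = <⇒<ᵇ≡true p

≥⇒<ᵇ≡false : ∀ {m n} → n ≤ m → (m <ᵇ n) ≡ false
≥⇒<ᵇ≡false {m}     {zero}  _       = refl
≥⇒<ᵇ≡false {suc m} {suc n} (s≤s p) = ≥⇒<ᵇ≡false p

≡ᵇ-refl : ∀ n → (n ≡ᵇ n) ≡ true
≡ᵇ-refl zero    = refl
≡ᵇ-refl (suc n) = ≡ᵇ-refl n

≢⇒≡ᵇ≡false : ∀ {m n} → m ≢ n → (m ≡ᵇ n) ≡ false
≢⇒≡ᵇ≡false {zero}  {zero}  m≢n = contradiction refl m≢n
≢⇒≡ᵇ≡false {zero}  {suc n} _   = refl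
≢⇒≡ᵇ≡false {suc m} {zero}  _   = refl
≢⇒≡ᵇ≡false {suc m} {suc n} m≢n = ≢⇒≡ᵇ≡false (m≢n ∘ cong suc)

+≡ᵇ⇔≡ᵇ∸ : ∀ a e d → (a + e ≡ᵇ d) ≡ (if e ≤ᵇ d then (a ≡ᵇ d ∸ e) else false)
+≡ᵇ⇔≡ᵇ∸ a zero    d       = cong (_≡ᵇ d) (+-identityʳ a)
+≡ᵇ⇔≡ᵇ∸ a (suc e) zero    = cong (_≡ᵇ 0) (+-suc a e)
+≡ᵇ⇔≡ᵇ∸ a (suc e) (suc d) = trans (cong (_≡ᵇ suc d) (+-suc a e))
  (trans (+≡ᵇ⇔≡ᵇ∸ a e d) (cong (λ b → if b then (a ≡ᵇ d ∸ e) else false) (<ᵇ-suc e d)))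
  where
  <ᵇ-suc : ∀ e d → (e ≤ᵇ d) ≡ (e <ᵇ suc d)
  <ᵇ-suc zero    d = refl
  <ᵇ-suc (suc e) d = refl

+-cancelˡ-<ᵇ : ∀ e a b → (e + a <ᵇ e + b) ≡ (a <ᵇ b)
+-cancelˡ-<ᵇ zero    a b = refl
+-cancelˡ-<ᵇ (suc e) a b = +-cancelˡ-<ᵇ e a b

∧-leftComm : ∀ a b c → a ∧ (b ∧ c) ≡ b ∧ (a ∧ c)
∧-leftComm true  b c = refl
∧-leftComm false b c = sym (∧-zeroʳ b)

Σ< : ℕ → (ℕ → ℕ) → ℕ
Σ< zero    f = 0
Σ< (suc m) f = f 0 + Σ< m (f ∘ suc)

Σ<-cong : ∀ m {f g : ℕ → ℕ} → (∀ t → t < m → f t ≡ g t) → Σ< m f ≡ Σ< m g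
Σ<-cong zero    f≗g = refl
Σ<-cong (suc m) f≗g = cong₂ _+_ (f≗g 0 (s≤s z≤n)) (Σ<-cong m (λ t t<m → f≗g (suc t) (s≤s t<m)))

Σ<-cong′ : ∀ {m m′} {f g : ℕ → ℕ} → m ≡ m′ → (∀ t → f t ≡ g t) → Σ< m f ≡ Σ< m′ g
Σ<-cong′ {m} refl f≗g = Σ<-cong m (λ t _ → f≗g t)

Σ<-zero : ∀ m {f : ℕ → ℕ} → (∀ t → t < m → f t ≡ 0) → Σ< m f ≡ 0
Σ<-zero zero    f≗0 = refl
Σ<-zero (suc m) f≗0 = cong₂ _+_ (f≗0 0 (s≤s z≤n)) (Σ<-zero m (λ t t<m → f≗0 (suc t) (s≤s t<m)))

Σ<-+ : ∀ m (f g : ℕ → ℕ) → Σ< m (λ t → f t + g t) ≡ Σ< m f + Σ< m g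
Σ<-+ zero    f g = refl
Σ<-+ (suc m) f g = trans (cong (f 0 + g 0 +_) (Σ<-+ m (f ∘ suc) (g ∘ suc))) (interchange (f 0) (g 0) _ _)

Σ<-swap : ∀ a b (f : ℕ → ℕ → ℕ) → Σ< a (λ x → Σ< b (f x)) ≡ Σ< b (λ y → Σ< a (λ x → f x y))
Σ<-swap zero    b f = sym (Σ<-zero b (λ _ _ → refl))
Σ<-swap (suc a) b f = trans (cong (Σ< b (f 0) +_) (Σ<-swap a b (f ∘ suc))) (sym (Σ<-+ b (f 0) _))

Σ<-last : ∀ m f → Σ< (suc m) f ≡ Σ< m f + f m
Σ<-last zero    f = +-comm (f 0) 0
Σ<-last (suc m) f = trans (cong (f 0 +_) (Σ<-last m (f ∘ suc))) (sym (+-assoc (f 0) _ _))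

Σ<-truncate : ∀ m m′ {f : ℕ → ℕ} → m ≤ m′ → (∀ t → m ≤ t → t < m′ → f t ≡ 0) → Σ< m′ f ≡ Σ< m f
Σ<-truncate zero    m′       _       f≗0 = Σ<-zero m′ (λ t → f≗0 t z≤n)
Σ<-truncate (suc m) (suc m′) (s≤s p) f≗0 =
  cong (_ +_) (Σ<-truncate m m′ p (λ t m≤t t<m′ → f≗0 (suc t) (s≤s m≤t) (s≤s t<m′)))

-- Σpairs m F = Σ_{i < j < m} F i j
Σpairs : ℕ → (ℕ → ℕ → ℕ) → ℕ
Σpairs m F = Σ< m (λ i → Σ< (m ∸ suc i) (λ t → F i (suc i + t)))

Σpairs-cong : ∀ m {F G : ℕ → ℕ → ℕ} → (∀ i j → i < j → j < m → F i j ≡ G i j) → Σpairs m F ≡ Σpairs m G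
Σpairs-cong m F≗G = Σ<-cong m (λ i i<m → Σ<-cong (m ∸ suc i) (λ t t<m-i →
  F≗G i (suc i + t) (s≤s (m≤m+n i t)) (subst (suc i + t <_) (m+[n∸m]≡n i<m) (+-monoʳ-< (suc i) t<m-i))))

Σpairs-truncate : ∀ m m′ {F : ℕ → ℕ → ℕ} → m ≤ m′ →
  (∀ i j → i < j → m ≤ j → j < m′ → F i j ≡ 0) → Σpairs m′ F ≡ Σpairs m F
Σpairs-truncate m m′ {F} m≤m′ F≡0 =
  trans (Σ<-cong m′ inner)
        (Σ<-truncate m m′ m≤m′ (λ i m≤i _ → cong (λ z → Σ< z (λ t → F i (suc i + t))) (m≤n⇒m∸n≡0 (m≤n⇒m≤1+n m≤i))))
  where
  inner : ∀ i → i < m′ → Σ< (m′ ∸ suc i) (λ t → F i (suc i + t)) ≡ Σ< (m ∸ suc i) (λ t → F i (suc i + t))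
  inner i i<m′ = Σ<-truncate (m ∸ suc i) (m′ ∸ suc i) (∸-monoˡ-≤ (suc i) m≤m′) (λ t a b →
    F≡0 i (suc i + t) (s≤s (m≤m+n i t)) (≤-trans (m≤n+m∸n m (suc i)) (+-monoʳ-≤ (suc i) a))
        (subst (suc i + t <_) (m+[n∸m]≡n i<m′) (+-monoʳ-< (suc i) b)))

Σ∈ : {A : Set} → List A → (A → ℕ) → ℕ
Σ∈ []       f = 0
Σ∈ (x ∷ xs) f = f x + Σ∈ xs f

Σ∈-++ : {A : Set} (xs ys : List A) (f : A → ℕ) → Σ∈ (xs ++ ys) f ≡ Σ∈ xs f + Σ∈ ys f
Σ∈-++ []       ys f = refl
Σ∈-++ (x ∷ xs) ys f = trans (cong (f x +_) (Σ∈-++ xs ys f)) (sym (+-assoc (f x) _ _))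

Σ∈-map : {A B : Set} (g : A → B) (xs : List A) (f : B → ℕ) → Σ∈ (map g xs) f ≡ Σ∈ xs (f ∘ g)
Σ∈-map g []       f = refl
Σ∈-map g (x ∷ xs) f = cong (f (g x) +_) (Σ∈-map g xs f)

Σ∈-concatMap : {A B : Set} (g : A → List B) (xs : List A) (f : B → ℕ) →
  Σ∈ (concatMap g xs) f ≡ Σ∈ xs (λ x → Σ∈ (g x) f)
Σ∈-concatMap g []       f = refl
Σ∈-concatMap g (x ∷ xs) f = trans (Σ∈-++ (g x) (concatMap g xs) f) (cong (Σ∈ (g x) f +_) (Σ∈-concatMap g xs f))

Σ∈-applyUpTo : (h : ℕ → ℕ) (m : ℕ) (f : ℕ → ℕ) → Σ∈ (applyUpTo h m) f ≡ Σ< m (f ∘ h)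
Σ∈-applyUpTo h zero    f = refl
Σ∈-applyUpTo h (suc m) f = cong (f (h 0) +_) (Σ∈-applyUpTo (h ∘ suc) m f)

Σ∈-range : ∀ a b (f : ℕ → ℕ) → Σ∈ (range a b) f ≡ Σ< (suc b ∸ a) (λ t → f (a + t))
Σ∈-range a b f = trans (cong (λ xs → Σ∈ xs f) (map-upTo (a +_) (suc b ∸ a))) (Σ∈-applyUpTo (a +_) (suc b ∸ a) f)

length-filterᵇ : {A : Set} (p : A → Bool) (xs : List A) → length (filterᵇ p xs) ≡ Σ∈ xs (boolToℕ ∘ p)
length-filterᵇ p []       = refl
length-filterᵇ p (x ∷ xs) with p x
... | true  = cong suc (length-filterᵇ p xs)
... | false = length-filterᵇ p xs

ΣP-coefficient : (Ps : List Poly) (d : ℕ) → ΣP Ps d ≡ Σ∈ Ps (λ P → P d)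
ΣP-coefficient []       d = refl
ΣP-coefficient (P ∷ Ps) d = cong (P d +_) (ΣP-coefficient Ps d)

all< : ℕ → (ℕ → Bool) → Bool
all< zero    p = true
all< (suc m) p = p 0 ∧ all< m (p ∘ suc)

all<-cong : ∀ m {p p′ : ℕ → Bool} → (∀ t → t < m → p t ≡ p′ t) → all< m p ≡ all< m p′
all<-cong zero    p≗p′ = refl
all<-cong (suc m) p≗p′ = cong₂ _∧_ (p≗p′ 0 (s≤s z≤n)) (all<-cong m (λ t t<m → p≗p′ (suc t) (s≤s t<m)))

all<-false : ∀ m {p : ℕ → Bool} t → t < m → p t ≡ false → all< m p ≡ false
all<-false (suc m)     zero    _         pt≡false rewrite pt≡false = refl
all<-false (suc m) {p} (suc t) (s≤s t<m) pt≡false rewrite all<-false m {p ∘ suc} t t<m pt≡false = ∧-zeroʳ (p 0)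

all<-last : ∀ m p → all< (suc m) p ≡ all< m p ∧ p m
all<-last zero    p = ∧-identityʳ (p 0)
all<-last (suc m) p = trans (cong (p 0 ∧_) (all<-last m (p ∘ suc))) (sym (∧-assoc (p 0) _ _))

allᵇ-applyUpTo : (h : ℕ → ℕ) (m : ℕ) (p : ℕ → Bool) → allᵇ p (applyUpTo h m) ≡ all< m (p ∘ h)
allᵇ-applyUpTo h zero    p = refl
allᵇ-applyUpTo h (suc m) p = cong (p (h 0) ∧_) (allᵇ-applyUpTo (h ∘ suc) m p)

allᵇ-range : ∀ a b (p : ℕ → Bool) → allᵇ p (range a b) ≡ all< (suc b ∸ a) (λ t → p (a + t))
allᵇ-range a b p = trans (cong (allᵇ p) (map-upTo (a +_) (suc b ∸ a))) (allᵇ-applyUpTo (a +_) (suc b ∸ a) p)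

IsWord : ℕ → ℕ → List ℕ → Set
IsWord m k c = length c ≡ m × All (_≤ k) c

Σword : ℕ → ℕ → (List ℕ → ℕ) → ℕ
Σword zero    k g = g []
Σword (suc m) k g = Σ< k (λ y → Σword m k (λ c → g (suc y ∷ c)))

Σword-cong : ∀ m k {g h : List ℕ → ℕ} → (∀ c → IsWord m k c → g c ≡ h c) → Σword m k g ≡ Σword m k h
Σword-cong zero    k g≗h = g≗h [] (refl , [])
Σword-cong (suc m) k g≗h = Σ<-cong k (λ y y<k →
  Σword-cong m k (λ c (len , bound) → g≗h (suc y ∷ c) (cong suc len , y<k ∷ bound)))

Σword-zero : ∀ m k {g : List ℕ → ℕ} → (∀ c → IsWord m k c → g c ≡ 0) → Σword m k g ≡ 0
Σword-zero zero    k g≗0 = g≗0 [] (refl , [])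
Σword-zero (suc m) k g≗0 = Σ<-zero k (λ y y<k →
  Σword-zero m k (λ c (len , bound) → g≗0 (suc y ∷ c) (cong suc len , y<k ∷ bound)))

Σ∈-allConfigs : ∀ m k (g : List ℕ → ℕ) → Σ∈ (allConfigs m k) g ≡ Σword m k g
Σ∈-allConfigs zero    k g = +-identityʳ (g [])
Σ∈-allConfigs (suc m) k g = begin
  Σ∈ (concatMap (λ j → map (j ∷_) (allConfigs m k)) (range 1 k)) g
    ≡⟨ Σ∈-concatMap (λ j → map (j ∷_) (allConfigs m k)) (range 1 k) g ⟩
  Σ∈ (range 1 k) (λ j → Σ∈ (map (j ∷_) (allConfigs m k)) g)
    ≡⟨ Σ∈-range 1 k _ ⟩
  Σ< k (λ y → Σ∈ (map (suc y ∷_) (allConfigs m k)) g)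
    ≡⟨ Σ<-cong k (λ y _ → trans (Σ∈-map (suc y ∷_) (allConfigs m k) g) (Σ∈-allConfigs m k _)) ⟩
  Σ< k (λ y → Σword m k (λ c → g (suc y ∷ c)))
    ∎
  where open ≡-Reasoning

𝔠-Σword : ∀ k lam d → 𝔠 k lam d ≡ Σword (2 * k) k (λ c → boolToℕ (isDellac k lam c ∧ (inv c ≡ᵇ d)))
𝔠-Σword k lam d = trans (length-filterᵇ _ (allConfigs (2 * k) k)) (Σ∈-allConfigs (2 * k) k _)

-- insertAt v t c puts v at the 0-based position t of c (at the end if t ≥ length c)
insertAt : ℕ → ℕ → List ℕ → List ℕ
insertAt v zero    c       = v ∷ c
insertAt v (suc t) []      = v ∷ []
insertAt v (suc t) (x ∷ c) = x ∷ insertAt v t c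

length-insertAt : ∀ v t c → length (insertAt v t c) ≡ suc (length c)
length-insertAt v zero    c       = refl
length-insertAt v (suc t) []      = refl
length-insertAt v (suc t) (x ∷ c) = cong suc (length-insertAt v t c)

insertAt₂ : ℕ → ℕ → ℕ → List ℕ → List ℕ
insertAt₂ v i j c = insertAt v j (insertAt v i c)

length-insertAt₂ : ∀ v i j c → length (insertAt₂ v i j c) ≡ suc (suc (length c))
length-insertAt₂ v i j c = trans (length-insertAt v j (insertAt v i c)) (cong suc (length-insertAt v i c))

length-filterᵇ-∷ : {A : Set} (p : A → Bool) (x : A) (xs : List A) →
  length (filterᵇ p (x ∷ xs)) ≡ boolToℕ (p x) + length (filterᵇ p xs)
length-filterᵇ-∷ p x xs with p x
... | true  = refl
... | false = refl

length-filterᵇ-insertAt : (p : ℕ → Bool) (v t : ℕ) (c : List ℕ) →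
  length (filterᵇ p (insertAt v t c)) ≡ length (filterᵇ p c) + boolToℕ (p v)
length-filterᵇ-insertAt p v zero    c       = trans (length-filterᵇ-∷ p v c) (+-comm (boolToℕ (p v)) _)
length-filterᵇ-insertAt p v (suc t) []      = trans (length-filterᵇ-∷ p v []) (+-comm (boolToℕ (p v)) 0)
length-filterᵇ-insertAt p v (suc t) (x ∷ c) = begin
  length (filterᵇ p (x ∷ insertAt v t c))                 ≡⟨ length-filterᵇ-∷ p x (insertAt v t c) ⟩
  boolToℕ (p x) + length (filterᵇ p (insertAt v t c))     ≡⟨ cong (boolToℕ (p x) +_) (length-filterᵇ-insertAt p v t c) ⟩
  boolToℕ (p x) + (length (filterᵇ p c) + boolToℕ (p v))  ≡⟨ sym (+-assoc (boolToℕ (p x)) _ _) ⟩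
  boolToℕ (p x) + length (filterᵇ p c) + boolToℕ (p v)    ≡⟨ cong (_+ boolToℕ (p v)) (sym (length-filterᵇ-∷ p x c)) ⟩
  length (filterᵇ p (x ∷ c)) + boolToℕ (p v)              ∎
  where open ≡-Reasoning

occ-∷-≢ : ∀ {v x} c → v ≢ x → occ v (x ∷ c) ≡ occ v c
occ-∷-≢ {v} {x} c v≢x = trans (length-filterᵇ-∷ (v ≡ᵇ_) x c) (cong (λ b → boolToℕ b + occ v c) (≢⇒≡ᵇ≡false v≢x))

occ-∷-≡ : ∀ v c → occ v (v ∷ c) ≡ suc (occ v c)
occ-∷-≡ v c = trans (length-filterᵇ-∷ (v ≡ᵇ_) v c) (cong (λ b → boolToℕ b + occ v c) (≡ᵇ-refl v))

occ-insertAt-≡ : ∀ v t c → occ v (insertAt v t c) ≡ suc (occ v c)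
occ-insertAt-≡ v t c = trans (length-filterᵇ-insertAt (v ≡ᵇ_) v t c)
  (trans (cong (λ b → occ v c + boolToℕ b) (≡ᵇ-refl v)) (+-comm (occ v c) 1))

occ-insertAt-≢ : ∀ {u v} t c → u ≢ v → occ u (insertAt v t c) ≡ occ u c
occ-insertAt-≢ {u} {v} t c u≢v = trans (length-filterᵇ-insertAt (u ≡ᵇ_) v t c)
  (trans (cong (λ b → occ u c + boolToℕ b) (≢⇒≡ᵇ≡false u≢v)) (+-identityʳ (occ u c)))

occ-absent : ∀ {k} v c → All (_≤ k) c → k < v → occ v c ≡ 0
occ-absent v []      []               _   = refl
occ-absent v (x ∷ c) (x≤k ∷ c≤k) k<v = trans (occ-∷-≢ c (λ v≡x → <-irrefl (sym v≡x) (≤-<-trans x≤k k<v))) (occ-absent v c c≤k k<v)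

-- Sorting words over [1, k+1] by the number of occurrences of the top letter k+1

Σword-occ : ℕ → ℕ → ℕ → (List ℕ → ℕ) → ℕ
Σword-occ k t m g = Σword m (suc k) (λ c → if occ (suc k) c ≡ᵇ t then g c else 0)

Σword-occ-∷ : ∀ k t m g → Σword-occ k t (suc m) g ≡
  Σ< k (λ y → Σword-occ k t m (λ c → g (suc y ∷ c))) +
  Σword m (suc k) (λ c → if suc (occ (suc k) c) ≡ᵇ t then g (suc k ∷ c) else 0)
Σword-occ-∷ k t m g = trans (Σ<-last k (λ y → Σword m (suc k) (λ c → if occ (suc k) (suc y ∷ c) ≡ᵇ t then g (suc y ∷ c) else 0)))
  (cong₂ _+_ (Σ<-cong k (λ y y<k → Σword-cong m (suc k) (λ c _ →
                cong (λ o → if o ≡ᵇ t then g (suc y ∷ c) else 0) (occ-∷-≢ c (y≢k y<k)))))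
             (Σword-cong m (suc k) (λ c _ → cong (λ o → if o ≡ᵇ t then g (suc k ∷ c) else 0) (occ-∷-≡ (suc k) c))))
  where
  y≢k : ∀ {y} → y < k → suc k ≢ suc y
  y≢k y<k k≡y = <-irrefl (sym (suc-injective k≡y)) y<k

Σword-occ-0 : ∀ k m g → Σword-occ k 0 m g ≡ Σword m k g
Σword-occ-0 k zero    g = refl
Σword-occ-0 k (suc m) g = begin
  Σword-occ k 0 (suc m) g
    ≡⟨ Σword-occ-∷ k 0 m g ⟩
  Σ< k (λ y → Σword-occ k 0 m (λ c → g (suc y ∷ c))) + Σword m (suc k) (λ _ → 0)
    ≡⟨ cong₂ _+_ (Σ<-cong k (λ y _ → Σword-occ-0 k m (λ c → g (suc y ∷ c)))) (Σword-zero m (suc k) (λ _ _ → refl)) ⟩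
  Σword (suc m) k g + 0
    ≡⟨ +-identityʳ _ ⟩
  Σword (suc m) k g
    ∎
  where open ≡-Reasoning

Σword-occ-1 : ∀ k m g → Σword-occ k 1 m g ≡ Σ< m (λ p → Σword (m ∸ 1) k (g ∘ insertAt (suc k) p))
Σword-occ-1 k zero    g = refl
Σword-occ-1 k (suc m) g = begin
  Σword-occ k 1 (suc m) g
    ≡⟨ Σword-occ-∷ k 1 m g ⟩
  Σ< k (λ y → Σword-occ k 1 m (g ∘ (suc y ∷_))) + Σword-occ k 0 m (g ∘ (top ∷_))
    ≡⟨ cong₂ _+_ (Σ<-cong k (λ y _ → Σword-occ-1 k m (g ∘ (suc y ∷_)))) (Σword-occ-0 k m (g ∘ (top ∷_))) ⟩
  Σ< k later + Σword m k (g ∘ (top ∷_))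
    ≡⟨ +-comm (Σ< k later) _ ⟩
  Σword m k (g ∘ (top ∷_)) + Σ< k later
    ≡⟨ cong (Σword m k (g ∘ (top ∷_)) +_) (after-first-letter m) ⟩
  Σ< (suc m) (λ p → Σword m k (g ∘ insertAt top p))
    ∎
  where
  open ≡-Reasoning
  top = suc k
  later : ℕ → ℕ
  later y = Σ< m (λ p → Σword (m ∸ 1) k (g ∘ (suc y ∷_) ∘ insertAt top p))
  after-first-letter : ∀ m → Σ< k (λ y → Σ< m (λ p → Σword (m ∸ 1) k (g ∘ (suc y ∷_) ∘ insertAt top p)))
                           ≡ Σ< m (λ p → Σword m k (g ∘ insertAt top (suc p)))
  after-first-letter zero     = Σ<-zero k (λ _ _ → refl)
  after-first-letter (suc m′) = Σ<-swap k (suc m′) (λ y p → Σword m′ k (g ∘ (suc y ∷_) ∘ insertAt top p))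

Σword-occ-2 : ∀ k m g →
  Σword-occ k 2 m g ≡ Σpairs m (λ i j → Σword (m ∸ 2) k (g ∘ insertAt₂ (suc k) i j))
Σword-occ-2 k zero    g = refl
Σword-occ-2 k (suc m) g = begin
  Σword-occ k 2 (suc m) g
    ≡⟨ Σword-occ-∷ k 2 m g ⟩
  Σ< k (λ y → Σword-occ k 2 m (g ∘ (suc y ∷_))) + Σword-occ k 1 m (g ∘ (top ∷_))
    ≡⟨ cong₂ _+_ (Σ<-cong k (λ y _ → Σword-occ-2 k m (g ∘ (suc y ∷_)))) (Σword-occ-1 k m (g ∘ (top ∷_))) ⟩
  Σ< k later + Σ< m first
    ≡⟨ +-comm (Σ< k later) (Σ< m first) ⟩
  Σ< m first + Σ< k later
    ≡⟨ cong (Σ< m first +_) (after-first-letter m) ⟩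
  Σpairs (suc m) (λ i j → Σword (suc m ∸ 2) k (g ∘ insertAt₂ top i j))
    ∎
  where
  open ≡-Reasoning
  top = suc k
  first : ℕ → ℕ
  first p = Σword (m ∸ 1) k (g ∘ insertAt₂ top 0 (suc p))
  later : ℕ → ℕ
  later y = Σpairs m (λ i j → Σword (m ∸ 2) k (g ∘ (suc y ∷_) ∘ insertAt₂ top i j))
  after-first-letter : ∀ m → Σ< k (λ y → Σpairs m (λ i j → Σword (m ∸ 2) k (g ∘ (suc y ∷_) ∘ insertAt₂ top i j)))
                           ≡ Σ< m (λ i → Σ< (m ∸ suc i) (λ t → Σword (m ∸ 1) k (g ∘ insertAt₂ top (suc i) (suc (suc i + t)))))
  after-first-letter zero           = Σ<-zero k (λ _ _ → refl)
  after-first-letter (suc zero)     = Σ<-zero k (λ _ _ → refl)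
  after-first-letter (suc (suc m′)) =
    trans (Σ<-swap k (suc (suc m′)) (λ y i → Σ< (suc m′ ∸ i) (λ t → Σword m′ k (g ∘ (suc y ∷_) ∘ insertAt₂ top i (suc i + t)))))
          (Σ<-cong (suc (suc m′)) (λ i _ → Σ<-swap k (suc m′ ∸ i) (λ y t → Σword m′ k (g ∘ (suc y ∷_) ∘ insertAt₂ top i (suc i + t)))))

-- Inversions created by inserting a letter larger than all others

count->-top : ∀ k c → All (_≤ k) c → length (filterᵇ (suc k <ᵇ_) c) ≡ 0
count->-top k []      []          = refl
count->-top k (x ∷ c) (x≤k ∷ c≤k) = trans (length-filterᵇ-∷ (suc k <ᵇ_) x c)
  (cong₂ (λ b r → boolToℕ b + r) (≥⇒<ᵇ≡false (m≤n⇒m≤1+n x≤k)) (count->-top k c c≤k))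

inv-insertAt-top : ∀ k t c → All (_≤ k) c → t ≤ length c → inv (insertAt (suc k) t c) ≡ inv c + t
inv-insertAt-top k zero    c       c≤k         _         = trans (cong (_+ inv c) (count->-top k c c≤k)) (sym (+-identityʳ (inv c)))
inv-insertAt-top k (suc t) (x ∷ c) (x≤k ∷ c≤k) (s≤s t≤c) = begin
  length (filterᵇ (x <ᵇ_) (insertAt (suc k) t c)) + inv (insertAt (suc k) t c)
    ≡⟨ cong₂ _+_ (length-filterᵇ-insertAt (x <ᵇ_) (suc k) t c) (inv-insertAt-top k t c c≤k t≤c) ⟩
  length (filterᵇ (x <ᵇ_) c) + boolToℕ (x <ᵇ suc k) + (inv c + t)
    ≡⟨ cong (λ b → length (filterᵇ (x <ᵇ_) c) + boolToℕ b + (inv c + t)) (<⇒<ᵇ≡true (s≤s x≤k)) ⟩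
  length (filterᵇ (x <ᵇ_) c) + 1 + (inv c + t)
    ≡⟨ rearrange (length (filterᵇ (x <ᵇ_) c)) (inv c) t ⟩
  length (filterᵇ (x <ᵇ_) c) + inv c + suc t
    ∎
  where
  open ≡-Reasoning
  rearrange : ∀ a b t → a + 1 + (b + t) ≡ a + b + suc t
  rearrange = solve-∀

inv-insertAt₂-top : ∀ k i j c → All (_≤ k) c → i < j → j ≤ suc (length c) →
  inv (insertAt₂ (suc k) i j c) ≡ inv c + i + (j ∸ 1)
inv-insertAt₂-top k zero (suc t) c c≤k _ (s≤s t≤c) = begin
  length (filterᵇ (suc k <ᵇ_) (insertAt (suc k) t c)) + inv (insertAt (suc k) t c)
    ≡⟨ cong₂ _+_ (length-filterᵇ-insertAt (suc k <ᵇ_) (suc k) t c) (inv-insertAt-top k t c c≤k t≤c) ⟩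
  length (filterᵇ (suc k <ᵇ_) c) + boolToℕ (suc k <ᵇ suc k) + (inv c + t)
    ≡⟨ cong₂ (λ r b → r + boolToℕ b + (inv c + t)) (count->-top k c c≤k) (≥⇒<ᵇ≡false (≤-refl {suc k})) ⟩
  inv c + t
    ≡⟨ cong (_+ t) (sym (+-identityʳ (inv c))) ⟩
  inv c + 0 + t
    ∎
  where open ≡-Reasoning
inv-insertAt₂-top k (suc i) (suc zero)    _       _           (s≤s ()) _
inv-insertAt₂-top k (suc i) (suc (suc j)) []      _           _        (s≤s ())
inv-insertAt₂-top k (suc i) (suc (suc j)) (x ∷ c) (x≤k ∷ c≤k) (s≤s i<j) (s≤s j≤c) = begin
  length (filterᵇ (x <ᵇ_) (insertAt (suc k) (suc j) (insertAt (suc k) i c))) + inv (insertAt (suc k) (suc j) (insertAt (suc k) i c))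
    ≡⟨ cong₂ _+_ (trans (length-filterᵇ-insertAt (x <ᵇ_) (suc k) (suc j) (insertAt (suc k) i c))
                        (cong (_+ x<top) (length-filterᵇ-insertAt (x <ᵇ_) (suc k) i c)))
                 (inv-insertAt₂-top k i (suc j) c c≤k i<j j≤c) ⟩
  length (filterᵇ (x <ᵇ_) c) + x<top + x<top + (inv c + i + j)
    ≡⟨ cong (λ b → length (filterᵇ (x <ᵇ_) c) + b + b + (inv c + i + j)) (cong boolToℕ (<⇒<ᵇ≡true (s≤s x≤k))) ⟩
  length (filterᵇ (x <ᵇ_) c) + 1 + 1 + (inv c + i + j)
    ≡⟨ rearrange (length (filterᵇ (x <ᵇ_) c)) (inv c) i j ⟩
  length (filterᵇ (x <ᵇ_) c) + inv c + suc i + suc j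
    ∎
  where
  open ≡-Reasoning
  x<top = boolToℕ (x <ᵇ suc k)
  rearrange : ∀ a b i j → a + 1 + 1 + (b + i + j) ≡ a + b + suc i + suc j
  rearrange = solve-∀

-- Reading the Dellac conditions row by row

-- 0-based version of entry: nth xs t = entry xs (suc t), 0 beyond the end
nth : List ℕ → ℕ → ℕ
nth []       _       = 0
nth (x ∷ xs) zero    = x
nth (x ∷ xs) (suc t) = nth xs t

entry-suc : ∀ xs t → entry xs (suc t) ≡ nth xs t
entry-suc []       t       = refl
entry-suc (x ∷ xs) zero    = refl
entry-suc (x ∷ xs) (suc t) = entry-suc xs t

entry-zero : ∀ xs → entry xs 0 ≡ 0
entry-zero []       = refl
entry-zero (x ∷ xs) = refl

nth-insertAt : ∀ v j c → j ≤ length c → nth (insertAt v j c) j ≡ v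
nth-insertAt v zero    c       _         = refl
nth-insertAt v (suc j) (x ∷ c) (s≤s j≤c) = nth-insertAt v j c j≤c

nth-drop : ∀ s c t → nth (drop s c) t ≡ nth c (s + t)
nth-drop zero    c       t = refl
nth-drop (suc s) []      t = refl
nth-drop (suc s) (x ∷ c) t = nth-drop s c t

nth-≤ : ∀ {k} c t → All (_≤ k) c → nth c t ≤ k
nth-≤ []      t       []          = z≤n
nth-≤ (x ∷ c) zero    (x≤k ∷ _)   = x≤k
nth-≤ (x ∷ c) (suc t) (_ ∷ c≤k)   = nth-≤ c t c≤k

nth-≥-length : ∀ xs t → length xs ≤ t → nth xs t ≡ 0
nth-≥-length []       t       _         = refl
nth-≥-length (x ∷ xs) (suc t) (s≤s len) = nth-≥-length xs t len

nth-map : ∀ (f : ℕ → ℕ) → f 0 ≡ 0 → ∀ xs r → nth (map f xs) r ≡ f (nth xs r)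
nth-map f f0≡0 []       r       = sym f0≡0
nth-map f f0≡0 (x ∷ xs) zero    = refl
nth-map f f0≡0 (x ∷ xs) (suc r) = nth-map f f0≡0 xs r

drop-insertAt : ∀ v t s c → t ≤ s → drop (suc s) (insertAt v t c) ≡ drop s c
drop-insertAt v zero    s       c       _       = refl
drop-insertAt v (suc t) (suc s) []      _       = refl
drop-insertAt v (suc t) (suc s) (x ∷ c) (s≤s p) = drop-insertAt v t s c p

drop-insertAt₂ : ∀ v i j s c → i < j → j ≤ suc s → drop (suc (suc s)) (insertAt₂ v i j c) ≡ drop s c
drop-insertAt₂ v i j s c i<j j≤s =
  trans (drop-insertAt v j (suc s) (insertAt v i c) j≤s) (drop-insertAt v i s c (≤-pred (≤-trans i<j j≤s)))

outsideᵇ : (ℕ → ℕ) → List ℕ → Bool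
outsideᵇ L []      = true
outsideᵇ L (x ∷ c) = (L 0 <ᵇ x) ∧ outsideᵇ (L ∘ suc) c

outsideᵇ-cong : ∀ c {L L′ : ℕ → ℕ} → (∀ r → L r ≡ L′ r) → outsideᵇ L c ≡ outsideᵇ L′ c
outsideᵇ-cong []      L≗L′ = refl
outsideᵇ-cong (x ∷ c) L≗L′ = cong₂ _∧_ (cong (_<ᵇ x) (L≗L′ 0)) (outsideᵇ-cong c (L≗L′ ∘ suc))

outsideᵇ-all< : ∀ c (L : ℕ → ℕ) → all< (length c) (λ t → L t <ᵇ nth c t) ≡ outsideᵇ L c
outsideᵇ-all< []      L = refl
outsideᵇ-all< (x ∷ c) L = cong ((L 0 <ᵇ x) ∧_) (outsideᵇ-all< c (L ∘ suc))

dropIndex : ℕ → (ℕ → ℕ) → ℕ → ℕ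
dropIndex zero    L r       = L (suc r)
dropIndex (suc t) L zero    = L 0
dropIndex (suc t) L (suc r) = dropIndex t (L ∘ suc) r

dropIndex-cong : ∀ t {L L′ : ℕ → ℕ} → (∀ r → L r ≡ L′ r) → ∀ r → dropIndex t L r ≡ dropIndex t L′ r
dropIndex-cong zero    L≗L′ r       = L≗L′ (suc r)
dropIndex-cong (suc t) L≗L′ zero    = L≗L′ 0
dropIndex-cong (suc t) L≗L′ (suc r) = dropIndex-cong t (L≗L′ ∘ suc) r

dropIndex-∘ : ∀ t (f L : ℕ → ℕ) r → dropIndex t (f ∘ L) r ≡ f (dropIndex t L r)
dropIndex-∘ zero    f L r       = refl
dropIndex-∘ (suc t) f L zero    = refl
dropIndex-∘ (suc t) f L (suc r) = dropIndex-∘ t f (L ∘ suc) r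

dropIndex-< : ∀ t (L : ℕ → ℕ) v → (∀ r → L r < v) → ∀ r → dropIndex t L r < v
dropIndex-< zero    L v L<v r       = L<v (suc r)
dropIndex-< (suc t) L v L<v zero    = L<v 0
dropIndex-< (suc t) L v L<v (suc r) = dropIndex-< t (L ∘ suc) v (L<v ∘ suc) r

outsideᵇ-insertAt : ∀ v t c (L : ℕ → ℕ) → t ≤ length c → outsideᵇ L (insertAt v t c) ≡ (L t <ᵇ v) ∧ outsideᵇ (dropIndex t L) c
outsideᵇ-insertAt v zero    c       L _         = refl
outsideᵇ-insertAt v (suc t) (x ∷ c) L (s≤s t≤c) =
  trans (cong ((L 0 <ᵇ x) ∧_) (outsideᵇ-insertAt v t c (L ∘ suc) t≤c))
        (∧-leftComm (L 0 <ᵇ x) (L (suc t) <ᵇ v) (outsideᵇ (dropIndex t (L ∘ suc)) c))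

removeAt : ℕ → List ℕ → List ℕ
removeAt t       []       = []
removeAt zero    (x ∷ xs) = xs
removeAt (suc t) (x ∷ xs) = x ∷ removeAt t xs

nth-removeAt : ∀ t xs r → nth (removeAt t xs) r ≡ dropIndex t (nth xs) r
nth-removeAt t       []       r       = sym (dropIndex-∘ t (λ _ → 0) (λ s → s) r)
nth-removeAt zero    (x ∷ xs) r       = refl
nth-removeAt (suc t) (x ∷ xs) zero    = refl
nth-removeAt (suc t) (x ∷ xs) (suc r) = nth-removeAt t xs r

upFrom : ℕ → ℕ → List ℕ
upFrom a zero    = []
upFrom a (suc m) = a ∷ upFrom (suc a) m

length-upFrom : ∀ a m → length (upFrom a m) ≡ m
length-upFrom a zero    = refl
length-upFrom a (suc m) = cong suc (length-upFrom (suc a) m)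

nth-upFrom : ∀ a m t → t < m → nth (upFrom a m) t ≡ a + t
nth-upFrom a (suc m) zero    _         = sym (+-identityʳ a)
nth-upFrom a (suc m) (suc t) (s≤s t<m) = trans (nth-upFrom (suc a) m t t<m) (sym (+-suc a t))

range-upFrom : ∀ a b → range a b ≡ upFrom a (suc b ∸ a)
range-upFrom a b = trans (map-upTo (a +_) (suc b ∸ a)) (applyUpTo-+ a (suc b ∸ a))
  where
  applyUpTo-cong : ∀ {f g : ℕ → ℕ} → (∀ t → f t ≡ g t) → ∀ m → applyUpTo f m ≡ applyUpTo g m
  applyUpTo-cong f≗g zero    = refl
  applyUpTo-cong f≗g (suc m) = cong₂ _∷_ (f≗g 0) (applyUpTo-cong (f≗g ∘ suc) m)
  applyUpTo-+ : ∀ a m → applyUpTo (a +_) m ≡ upFrom a m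
  applyUpTo-+ a zero    = refl
  applyUpTo-+ a (suc m) = cong₂ _∷_ (+-identityʳ a)
    (trans (applyUpTo-cong (λ t → +-suc a t) m) (applyUpTo-+ (suc a) m))

avoids : ℕ → ℕ → ℕ → Bool
avoids I J r = not (r ≡ᵇ I) ∧ not (r ≡ᵇ J)

avoids-≢ : ∀ {I J r} → r ≢ I → r ≢ J → avoids I J r ≡ true
avoids-≢ r≢I r≢J = cong₂ (λ x y → not x ∧ not y) (≢⇒≡ᵇ≡false r≢I) (≢⇒≡ᵇ≡false r≢J)

filterᵇ-∷-true : {A : Set} (p : A → Bool) (x : A) (xs : List A) → p x ≡ true → filterᵇ p (x ∷ xs) ≡ x ∷ filterᵇ p xs
filterᵇ-∷-true p x xs px≡true with p x
... | true = refl

filterᵇ-∷-false : {A : Set} (p : A → Bool) (x : A) (xs : List A) → p x ≡ false → filterᵇ p (x ∷ xs) ≡ filterᵇ p xs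
filterᵇ-∷-false p x xs px≡false with p x
... | false = refl

∸-suc : ∀ {a J} → a < J → J ∸ a ≡ suc (J ∸ suc a)
∸-suc {zero}  {suc J} _         = refl
∸-suc {suc a} {suc J} (s≤s a<J) = ∸-suc a<J

filterᵇ-avoids-id : ∀ I J a m → I < a → J < a → filterᵇ (avoids I J) (upFrom a m) ≡ upFrom a m
filterᵇ-avoids-id I J a zero    I<a J<a = refl
filterᵇ-avoids-id I J a (suc m) I<a J<a =
  trans (filterᵇ-∷-true (avoids I J) a (upFrom (suc a) m) (avoids-≢ (>⇒≢ I<a) (>⇒≢ J<a)))
        (cong (a ∷_) (filterᵇ-avoids-id I J (suc a) m (m≤n⇒m≤1+n I<a) (m≤n⇒m≤1+n J<a)))

filterᵇ-avoids-removeAt : ∀ I J a m → I < a → a ≤ J → filterᵇ (avoids I J) (upFrom a m) ≡ removeAt (J ∸ a) (upFrom a m)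
filterᵇ-avoids-removeAt I J a zero    I<a a≤J = refl
filterᵇ-avoids-removeAt I J a (suc m) I<a a≤J with <-cmp a J
... | tri< a<J _ _ rewrite ∸-suc a<J =
  trans (filterᵇ-∷-true (avoids I J) a (upFrom (suc a) m) (avoids-≢ (>⇒≢ I<a) (<⇒≢ a<J)))
        (cong (a ∷_) (filterᵇ-avoids-removeAt I J (suc a) m (m≤n⇒m≤1+n I<a) a<J))
... | tri≈ _ refl _ rewrite n∸n≡0 a =
  trans (filterᵇ-∷-false (avoids I a) a (upFrom (suc a) m) (trans (cong (λ y → not (a ≡ᵇ I) ∧ not y) (≡ᵇ-refl a)) (∧-zeroʳ _)))
        (filterᵇ-avoids-id I a (suc a) m (m≤n⇒m≤1+n I<a) ≤-refl)
... | tri> _ _ J<a = contradiction a≤J (<⇒≱ J<a)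

filterᵇ-avoids-removeAt₂ : ∀ I J a m → a ≤ I → I < J →
  filterᵇ (avoids I J) (upFrom a m) ≡ removeAt (I ∸ a) (removeAt (J ∸ a) (upFrom a m))
filterᵇ-avoids-removeAt₂ I J a zero    a≤I I<J = refl
filterᵇ-avoids-removeAt₂ I J a (suc m) a≤I I<J with <-cmp a I
... | tri< a<I _ _ rewrite ∸-suc a<I | ∸-suc (<-trans a<I I<J) =
  trans (filterᵇ-∷-true (avoids I J) a (upFrom (suc a) m) (avoids-≢ (<⇒≢ a<I) (<⇒≢ (<-trans a<I I<J))))
        (cong (a ∷_) (filterᵇ-avoids-removeAt₂ I J (suc a) m a<I I<J))
... | tri≈ _ refl _ rewrite n∸n≡0 a | ∸-suc I<J =
  trans (filterᵇ-∷-false (avoids a J) a (upFrom (suc a) m) (cong (λ y → not y ∧ not (a ≡ᵇ J)) (≡ᵇ-refl a)))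
        (filterᵇ-avoids-removeAt a J (suc a) m ≤-refl I<J)
... | tri> _ _ I<a = contradiction a≤I (<⇒≱ I<a)

nth-delete2 : ∀ n lam i j → i < j → length lam ≤ suc n → ∀ r →
  nth (delete2 n lam (suc i) (suc j)) r ≡ dropIndex i (dropIndex j (nth lam)) r
nth-delete2 n lam i j i<j lam≤ r = begin
  nth (map (entry lam) (filterᵇ (avoids (suc i) (suc j)) (range 1 (n + 1)))) r
    ≡⟨ cong (λ xs → nth (map (entry lam) (filterᵇ (avoids (suc i) (suc j)) xs)) r) (range-upFrom 1 (n + 1)) ⟩
  nth (map (entry lam) (filterᵇ (avoids (suc i) (suc j)) rows)) r
    ≡⟨ cong (λ xs → nth (map (entry lam) xs) r) (filterᵇ-avoids-removeAt₂ (suc i) (suc j) 1 (n + 1) (s≤s z≤n) (s≤s i<j)) ⟩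
  nth (map (entry lam) (removeAt i (removeAt j rows))) r
    ≡⟨ nth-map (entry lam) (entry-zero lam) (removeAt i (removeAt j rows)) r ⟩
  entry lam (nth (removeAt i (removeAt j rows)) r)
    ≡⟨ cong (entry lam) (trans (nth-removeAt i (removeAt j rows) r) (dropIndex-cong i (nth-removeAt j rows) r)) ⟩
  entry lam (dropIndex i (dropIndex j (nth rows)) r)
    ≡⟨ sym (trans (dropIndex-cong i (dropIndex-∘ j (entry lam) (nth rows)) r) (dropIndex-∘ i (entry lam) _ r)) ⟩
  dropIndex i (dropIndex j (entry lam ∘ nth rows)) r
    ≡⟨ dropIndex-cong i (dropIndex-cong j entry-rows) r ⟩
  dropIndex i (dropIndex j (nth lam)) r
    ∎
  where
  open ≡-Reasoning
  rows = upFrom 1 (n + 1)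
  entry-rows : ∀ s → entry lam (nth rows s) ≡ nth lam s
  entry-rows s with s <? n + 1
  ... | yes s<n+1 = trans (cong (entry lam) (nth-upFrom 1 (n + 1) s s<n+1)) (entry-suc lam s)
  ... | no  s≮n+1 = begin
    entry lam (nth rows s) ≡⟨ cong (entry lam) (nth-≥-length rows s (subst (_≤ s) (sym (length-upFrom 1 (n + 1))) (≮⇒≥ s≮n+1))) ⟩
    entry lam 0            ≡⟨ entry-zero lam ⟩
    0                      ≡⟨ sym (nth-≥-length lam s (≤-trans lam≤ (subst (_≤ s) (+-comm n 1) (≮⇒≥ s≮n+1)))) ⟩
    nth lam s              ∎

columnsᵇ : ℕ → List ℕ → Bool
columnsᵇ M c = all< M (λ t → occ (suc t) c ≡ᵇ 2)

-- Row M + 2 + t (1-based) holds entry t of drop (suc M) c, and the staircase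
-- condition c + (M + 2 + t) < 2M + 2 there reads c + t < M.
staircaseᵇ : ℕ → List ℕ → Bool
staircaseᵇ M c = all< (M ∸ 1) (λ t → nth (drop (suc M) c) t + t <ᵇ M)

isDellac-split : ∀ m lam c → length c ≡ 2 * suc m →
  isDellac (suc m) lam c ≡ columnsᵇ (suc m) c ∧ (outsideᵇ (nth lam) c ∧ staircaseᵇ (suc m) c)
isDellac-split m lam c len = cong₂ _∧_ (allᵇ-range 1 M (λ j → occ j c ≡ᵇ 2)) (cong₂ _∧_ outside staircase)
  where
  M = suc m
  outside : allᵇ (λ i → entry lam i <ᵇ entry c i) (range 1 (2 * M)) ≡ outsideᵇ (nth lam) c
  outside = begin
    allᵇ (λ i → entry lam i <ᵇ entry c i) (range 1 (2 * M))   ≡⟨ allᵇ-range 1 (2 * M) _ ⟩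
    all< (2 * M) (λ t → entry lam (suc t) <ᵇ entry c (suc t)) ≡⟨ all<-cong (2 * M) (λ t _ → cong₂ _<ᵇ_ (entry-suc lam t) (entry-suc c t)) ⟩
    all< (2 * M) (λ t → nth lam t <ᵇ nth c t)                 ≡⟨ cong (λ z → all< z (λ t → nth lam t <ᵇ nth c t)) (sym len) ⟩
    all< (length c) (λ t → nth lam t <ᵇ nth c t)              ≡⟨ outsideᵇ-all< c (nth lam) ⟩
    outsideᵇ (nth lam) c                                       ∎
    where open ≡-Reasoning
  lowerRows : suc (2 * M) ∸ (M + 2) ≡ m
  lowerRows = trans (cong (_∸ (M + 2)) (rearrange m)) (m+n∸m≡n (M + 2) m)
    where
    rearrange : ∀ m → suc (2 * suc m) ≡ (suc m + 2) + m
    rearrange = solve-∀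
  row : ∀ t → (entry c (M + 2 + t) + (M + 2 + t) <ᵇ 2 * M + 2) ≡ (nth (drop (suc M) c) t + t <ᵇ M)
  row t = begin
    entry c (M + 2 + t) + (M + 2 + t) <ᵇ 2 * M + 2          ≡⟨ cong₂ _<ᵇ_ (rearrange₁ (entry c (M + 2 + t)) M t) (rearrange₂ M) ⟩
    (M + 2) + (entry c (M + 2 + t) + t) <ᵇ (M + 2) + M      ≡⟨ +-cancelˡ-<ᵇ (M + 2) _ M ⟩
    entry c (M + 2 + t) + t <ᵇ M                            ≡⟨ cong (λ x → x + t <ᵇ M) entry≡ ⟩
    nth (drop (suc M) c) t + t <ᵇ M                         ∎
    where
    open ≡-Reasoning
    rearrange₁ : ∀ x M t → x + (M + 2 + t) ≡ (M + 2) + (x + t)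
    rearrange₁ = solve-∀
    rearrange₂ : ∀ M → 2 * M + 2 ≡ (M + 2) + M
    rearrange₂ = solve-∀
    row≡ : ∀ M t → M + 2 + t ≡ suc (suc M + t)
    row≡ = solve-∀
    entry≡ : entry c (M + 2 + t) ≡ nth (drop (suc M) c) t
    entry≡ = trans (cong (entry c) (row≡ M t)) (trans (entry-suc c (suc M + t)) (sym (nth-drop (suc M) c t)))
  staircase : allᵇ (λ i → (entry c i + i) <ᵇ (2 * M + 2)) (range (M + 2) (2 * M)) ≡ staircaseᵇ M c
  staircase = trans (allᵇ-range (M + 2) (2 * M) _)
    (trans (cong (λ z → all< z (λ t → entry c (M + 2 + t) + (M + 2 + t) <ᵇ 2 * M + 2)) lowerRows)
           (all<-cong m (λ t _ → row t)))

-- Removing the last column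

columnsᵇ-insertAt₂-top : ∀ k i j c → All (_≤ k) c →
  columnsᵇ (suc k) (insertAt₂ (suc k) i j c) ≡ columnsᵇ k c
columnsᵇ-insertAt₂-top k i j c c≤k = begin
  columnsᵇ (suc k) c₂
    ≡⟨ all<-last k (λ t → occ (suc t) c₂ ≡ᵇ 2) ⟩
  columnsᵇ k c₂ ∧ (occ (suc k) c₂ ≡ᵇ 2)
    ≡⟨ cong₂ _∧_ (all<-cong k (λ t t<k → cong (_≡ᵇ 2) (occ-below t t<k))) (cong (_≡ᵇ 2) occ-top) ⟩
  columnsᵇ k c ∧ true
    ≡⟨ ∧-identityʳ (columnsᵇ k c) ⟩
  columnsᵇ k c
    ∎
  where
  open ≡-Reasoning
  c₂ = insertAt₂ (suc k) i j c
  occ-top : occ (suc k) c₂ ≡ 2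
  occ-top = trans (occ-insertAt-≡ (suc k) j _) (cong suc (trans (occ-insertAt-≡ (suc k) i c)
                  (cong suc (occ-absent (suc k) c c≤k ≤-refl))))
  occ-below : ∀ t → t < k → occ (suc t) c₂ ≡ occ (suc t) c
  occ-below t t<k = trans (occ-insertAt-≢ j _ t≢k) (occ-insertAt-≢ i c t≢k)
    where
    t≢k : suc t ≢ suc k
    t≢k = <⇒≢ (s≤s t<k)

outsideᵇ-insertAt₂ : ∀ v i j c (L : ℕ → ℕ) → i < j → j ≤ suc (length c) → (∀ r → L r < v) →
  outsideᵇ L (insertAt₂ v i j c) ≡ outsideᵇ (dropIndex i (dropIndex j L)) c
outsideᵇ-insertAt₂ v i j c L i<j j≤ L<v = begin
  outsideᵇ L (insertAt₂ v i j c)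
    ≡⟨ outsideᵇ-insertAt v j (insertAt v i c) L (subst (j ≤_) (sym (length-insertAt v i c)) j≤) ⟩
  (L j <ᵇ v) ∧ outsideᵇ (dropIndex j L) (insertAt v i c)
    ≡⟨ cong₂ _∧_ (<⇒<ᵇ≡true (L<v j)) (outsideᵇ-insertAt v i c (dropIndex j L) (≤-pred (≤-trans i<j j≤))) ⟩
  (dropIndex j L i <ᵇ v) ∧ outsideᵇ (dropIndex i (dropIndex j L)) c
    ≡⟨ cong (_∧ outsideᵇ (dropIndex i (dropIndex j L)) c) (<⇒<ᵇ≡true (dropIndex-< j L v L<v i)) ⟩
  outsideᵇ (dropIndex i (dropIndex j L)) c
    ∎
  where open ≡-Reasoning

staircaseᵇ-insertAt₂-top : ∀ k′ i j c → All (_≤ suc k′) c → i < j → j ≤ suc (suc k′) →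
  staircaseᵇ (suc (suc k′)) (insertAt₂ (suc (suc k′)) i j c) ≡ staircaseᵇ (suc k′) c
staircaseᵇ-insertAt₂-top k′ i j c c≤k i<j j≤n =
  trans (cong (λ c′ → all< k (λ t → nth c′ t + t <ᵇ n)) (drop-insertAt₂ n i j k c i<j j≤n))
        (cong₂ _∧_ (<⇒<ᵇ≡true (s≤s (≤-trans (≤-reflexive (+-identityʳ _)) (nth-≤ (drop k c) 0 (drop⁺ k c≤k)))))
                   (all<-cong k′ (λ t _ → shift t)))
  where
  k = suc k′
  n = suc k
  shift : ∀ t → (nth (drop k c) (suc t) + suc t <ᵇ n) ≡ (nth (drop n c) t + t <ᵇ k)
  shift t = trans (cong (_<ᵇ n) (+-suc (nth (drop k c) (suc t)) t))
    (cong (λ x → x + t <ᵇ k) (trans (nth-drop k c (suc t)) (trans (cong (nth c) (+-suc k t)) (sym (nth-drop n c t)))))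

staircaseᵇ-top-below : ∀ m c j → suc m < j → j < 2 * suc m → nth c j ≡ suc m → staircaseᵇ (suc m) c ≡ false
staircaseᵇ-top-below m c j m+1<j j<2m+2 cj≡top =
  all<-false m t t<m (trans (cong (λ x → x + t <ᵇ suc m) (trans (nth-drop (suc (suc m)) c t) (trans (cong (nth c) j≡) cj≡top)))
                            (≥⇒<ᵇ≡false (m≤m+n (suc m) t)))
  where
  t = j ∸ suc (suc m)
  j≡ : suc (suc m) + t ≡ j
  j≡ = m+[n∸m]≡n m+1<j
  2m+2≡ : ∀ m → 2 * suc m ≡ suc (suc m) + m
  2m+2≡ = solve-∀
  t<m : t < m
  t<m = +-cancelˡ-< (suc (suc m)) t m (subst₂ _<_ (sym j≡) (2m+2≡ m) j<2m+2)

isDellac-occ-top : ∀ k lam c → (occ (suc k) c ≡ᵇ 2) ≡ false → isDellac (suc k) lam c ≡ false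
isDellac-occ-top k lam c occ≢2 =
  cong (λ b → b ∧ (allᵇ (λ i → entry lam i <ᵇ entry c i) (range 1 (2 * suc k)) ∧
                   allᵇ (λ i → (entry c i + i) <ᵇ (2 * suc k + 2)) (range (suc k + 2) (2 * suc k))))
       (trans (allᵇ-range 1 (suc k) (λ j → occ j c ≡ᵇ 2)) (all<-false (suc k) {λ t → occ (suc t) c ≡ᵇ 2} k ≤-refl occ≢2))

q^·-cong : ∀ e {P Q : Poly} → P ≈P Q → (q^ e · P) ≈P (q^ e · Q)
q^·-cong e P≈Q d = cong (λ z → if e ≤ᵇ d then z else 0) (P≈Q (d ∸ e))

q^·-zeroP : ∀ e {P : Poly} → P ≈P zeroP → (q^ e · P) ≈P zeroP
q^·-zeroP e P≈0 d with e ≤ᵇ d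
... | true  = P≈0 (d ∸ e)
... | false = refl

Σword-inv-shift : ∀ m k (X : List ℕ → Bool) e d →
  Σword m k (λ c → boolToℕ (X c ∧ (inv c + e ≡ᵇ d))) ≡ (q^ e · (λ d′ → Σword m k (λ c → boolToℕ (X c ∧ (inv c ≡ᵇ d′))))) d
Σword-inv-shift m k X e d = shift (e ≤ᵇ d) (λ c → +≡ᵇ⇔≡ᵇ∸ (inv c) e d)
  where
  shift : ∀ b → (∀ c → (inv c + e ≡ᵇ d) ≡ (if b then (inv c ≡ᵇ d ∸ e) else false)) →
    Σword m k (λ c → boolToℕ (X c ∧ (inv c + e ≡ᵇ d))) ≡ (if b then Σword m k (λ c → boolToℕ (X c ∧ (inv c ≡ᵇ d ∸ e))) else 0)
  shift true  eq = Σword-cong m k (λ c _ → cong (λ z → boolToℕ (X c ∧ z)) (eq c))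
  shift false eq = Σword-zero m k (λ c _ → trans (cong (λ z → boolToℕ (X c ∧ z)) (eq c)) (cong boolToℕ (∧-zeroʳ (X c))))

length-insertAt₂-word : ∀ v i j c k → length c ≡ 2 * k → length (insertAt₂ v i j c) ≡ 2 * suc k
length-insertAt₂-word v i j c k len = trans (length-insertAt₂ v i j c) (trans (cong (λ z → suc (suc z)) len) (2k+2≡ k))
  where
  2k+2≡ : ∀ k → suc (suc (2 * k)) ≡ 2 * suc k
  2k+2≡ = solve-∀

≤-suc-length : ∀ {j} k (c : List ℕ) → length c ≡ 2 * k → j ≤ suc k → j ≤ suc (length c)
≤-suc-length {j} k c len j≤k+1 = subst (λ z → j ≤ suc z) (sym len) (≤-trans j≤k+1 (s≤s (m≤m+n k (k + 0))))

isDellac-insertAt₂-top-below : ∀ k′ lam i j c → IsWord (2 * suc k′) (suc k′) c → suc (suc k′) < j → j < 2 * suc (suc k′) →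
  isDellac (suc (suc k′)) lam (insertAt₂ (suc (suc k′)) i j c) ≡ false
isDellac-insertAt₂-top-below k′ lam i j c (len , _) n<j j<2n = begin
  isDellac n lam c₂
    ≡⟨ isDellac-split (suc k′) lam c₂ (length-insertAt₂-word n i j c (suc k′) len) ⟩
  columnsᵇ n c₂ ∧ (outsideᵇ (nth lam) c₂ ∧ staircaseᵇ n c₂)
    ≡⟨ cong (λ b → columnsᵇ n c₂ ∧ (outsideᵇ (nth lam) c₂ ∧ b))
            (staircaseᵇ-top-below (suc k′) c₂ j n<j j<2n (nth-insertAt n j (insertAt n i c) j≤)) ⟩
  columnsᵇ n c₂ ∧ (outsideᵇ (nth lam) c₂ ∧ false)
    ≡⟨ trans (cong (columnsᵇ n c₂ ∧_) (∧-zeroʳ _)) (∧-zeroʳ _) ⟩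
  false
    ∎
  where
  open ≡-Reasoning
  n = suc (suc k′)
  c₂ = insertAt₂ n i j c
  2n≡ : ∀ k → 2 * suc k ≡ suc (suc (2 * k))
  2n≡ = solve-∀
  j≤ : j ≤ length (insertAt n i c)
  j≤ = subst (j ≤_) (sym (trans (length-insertAt n i c) (cong suc len))) (≤-pred (subst (j <_) (2n≡ (suc k′)) j<2n))

ΣP-range : ∀ a b (Q : ℕ → Poly) d → ΣP (map Q (range a b)) d ≡ Σ< (suc b ∸ a) (λ t → Q (a + t) d)
ΣP-range a b Q d = trans (ΣP-coefficient (map Q (range a b)) d) (trans (Σ∈-map Q (range a b) (λ P → P d)) (Σ∈-range a b (λ i → Q i d)))

ΣP-pairs : ∀ N (Q : ℕ → ℕ → Poly) d →
  ΣP (concatMap (λ i → map (Q i) (range (i + 1) N)) (range 1 N)) d ≡ Σpairs N (λ i j → Q (suc i) (suc j) d)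
ΣP-pairs N Q d = begin
  ΣP (concatMap (λ i → map (Q i) (range (i + 1) N)) (range 1 N)) d
    ≡⟨ ΣP-coefficient (concatMap (λ i → map (Q i) (range (i + 1) N)) (range 1 N)) d ⟩
  Σ∈ (concatMap (λ i → map (Q i) (range (i + 1) N)) (range 1 N)) (λ P → P d)
    ≡⟨ Σ∈-concatMap (λ i → map (Q i) (range (i + 1) N)) (range 1 N) (λ P → P d) ⟩
  Σ∈ (range 1 N) (λ i → Σ∈ (map (Q i) (range (i + 1) N)) (λ P → P d))
    ≡⟨ Σ∈-range 1 N _ ⟩
  Σ< N (λ i → Σ∈ (map (Q (suc i)) (range (suc i + 1) N)) (λ P → P d))
    ≡⟨ Σ<-cong N (λ i _ → trans (Σ∈-map (Q (suc i)) (range (suc i + 1) N) (λ P → P d)) (Σ∈-range (suc i + 1) N (λ j → Q (suc i) j d))) ⟩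
  Σ< N (λ i → Σ< (suc N ∸ (suc i + 1)) (λ t → Q (suc i) (suc i + 1 + t) d))
    ≡⟨ Σ<-cong N (λ i _ → Σ<-cong′ (cong (N ∸_) (+-comm i 1)) (λ t → cong (λ j → Q (suc i) j d) (index≡ i t))) ⟩
  Σpairs N (λ i j → Q (suc i) (suc j) d)
    ∎
  where
  open ≡-Reasoning
  index≡ : ∀ i t → suc i + 1 + t ≡ suc (suc i + t)
  index≡ = solve-∀

Σpairs-first-row : ∀ m (F : ℕ → ℕ → ℕ) → (∀ i j → suc i < j → F (suc i) j ≡ 0) → Σpairs (suc m) F ≡ Σ< m (F 0 ∘ suc)
Σpairs-first-row m F F≡0 =
  trans (cong (Σ< m (F 0 ∘ suc) +_) (Σ<-zero m (λ i _ → Σ<-zero (m ∸ suc i) (λ t _ → F≡0 i (suc (suc i) + t) (s≤s (s≤s (m≤m+n i t)))))))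
        (+-identityʳ _)

𝔠-first-row-full : ∀ k′ lam → suc k′ ≤ nth lam 0 → 𝔠 (suc k′) lam ≈P zeroP
𝔠-first-row-full k′ lam k≤λ₁ d = trans (𝔠-Σword (suc k′) lam d) (Σword-zero (2 * suc k′) (suc k′) no-dot-in-row-1)
  where
  no-dot-in-row-1 : ∀ c → IsWord (2 * suc k′) (suc k′) c → boolToℕ (isDellac (suc k′) lam c ∧ (inv c ≡ᵇ d)) ≡ 0
  no-dot-in-row-1 (x ∷ c) (len , x≤k ∷ _) = cong (λ b → boolToℕ (b ∧ (inv (x ∷ c) ≡ᵇ d))) (begin
    isDellac (suc k′) lam (x ∷ c)
      ≡⟨ isDellac-split k′ lam (x ∷ c) len ⟩
    columnsᵇ (suc k′) (x ∷ c) ∧ (((nth lam 0 <ᵇ x) ∧ outsideᵇ (nth lam ∘ suc) c) ∧ staircaseᵇ (suc k′) (x ∷ c))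
      ≡⟨ cong (λ b → columnsᵇ (suc k′) (x ∷ c) ∧ ((b ∧ outsideᵇ (nth lam ∘ suc) c) ∧ staircaseᵇ (suc k′) (x ∷ c)))
              (≥⇒<ᵇ≡false (≤-trans x≤k k≤λ₁)) ⟩
    columnsᵇ (suc k′) (x ∷ c) ∧ false
      ≡⟨ ∧-zeroʳ _ ⟩
    false
      ∎)
    where open ≡-Reasoning

module _ (k′ : ℕ) (lam : List ℕ) (lam<n : ∀ r → nth lam r < suc (suc k′))
         (length-lam : length lam ≤ suc (suc (suc k′))) where

  private
    k = suc k′
    n = suc k

    Dellac-with-inv : ℕ → List ℕ → ℕ
    Dellac-with-inv d c = boolToℕ (isDellac n lam c ∧ (inv c ≡ᵇ d))

    pairTerm : ℕ → ℕ → Poly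
    pairTerm i j = q^ (suc i + suc j ∸ 3) · 𝔠 k (delete2 n lam (suc i) (suc j))

  isDellac-insertAt₂-top : ∀ i j c → IsWord (2 * k) k c → i < j → j ≤ n →
    isDellac n lam (insertAt₂ n i j c) ≡ isDellac k (delete2 n lam (suc i) (suc j)) c
  isDellac-insertAt₂-top i j c (len , c≤k) i<j j≤n = begin
    isDellac n lam c₂
      ≡⟨ isDellac-split k lam c₂ (length-insertAt₂-word n i j c k len) ⟩
    columnsᵇ n c₂ ∧ (outsideᵇ (nth lam) c₂ ∧ staircaseᵇ n c₂)
      ≡⟨ cong₂ _∧_ (columnsᵇ-insertAt₂-top k i j c c≤k) (cong₂ _∧_ outside (staircaseᵇ-insertAt₂-top k′ i j c c≤k i<j j≤n)) ⟩
    columnsᵇ k c ∧ (outsideᵇ (nth lam′) c ∧ staircaseᵇ k c)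
      ≡⟨ sym (isDellac-split k′ lam′ c len) ⟩
    isDellac k lam′ c
      ∎
    where
    open ≡-Reasoning
    c₂ = insertAt₂ n i j c
    lam′ = delete2 n lam (suc i) (suc j)
    outside : outsideᵇ (nth lam) c₂ ≡ outsideᵇ (nth lam′) c
    outside = trans (outsideᵇ-insertAt₂ n i j c (nth lam) i<j (≤-suc-length k c len j≤n) lam<n)
                    (outsideᵇ-cong c (λ r → sym (nth-delete2 n lam i j i<j length-lam r)))

  Σword-remove-last-column : ∀ d i j → i < j → j ≤ n →
    Σword (2 * k) k (Dellac-with-inv d ∘ insertAt₂ n i j) ≡ pairTerm i j d
  Σword-remove-last-column d i (suc j) i<j j≤n = begin
    Σword (2 * k) k (Dellac-with-inv d ∘ insertAt₂ n i (suc j))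
      ≡⟨ Σword-cong (2 * k) k (λ c w → cong₂ (λ b x → boolToℕ (b ∧ (x ≡ᵇ d)))
           (isDellac-insertAt₂-top i (suc j) c w i<j j≤n) (inversions c w)) ⟩
    Σword (2 * k) k (λ c → boolToℕ (isDellac k lam′ c ∧ (inv c + e ≡ᵇ d)))
      ≡⟨ Σword-inv-shift (2 * k) k (isDellac k lam′) e d ⟩
    (q^ e · (λ d′ → Σword (2 * k) k (λ c → boolToℕ (isDellac k lam′ c ∧ (inv c ≡ᵇ d′))))) d
      ≡⟨ q^·-cong e (λ d′ → sym (𝔠-Σword k lam′ d′)) d ⟩
    (q^ e · 𝔠 k lam′) d
      ∎
    where
    open ≡-Reasoning
    lam′ = delete2 n lam (suc i) (suc (suc j))
    e = suc i + suc (suc j) ∸ 3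
    e≡ : e ≡ i + j
    e≡ = cong (_∸ 2) (trans (+-suc i (suc j)) (cong suc (+-suc i j)))
    inversions : ∀ c → IsWord (2 * k) k c → inv (insertAt₂ n i (suc j) c) ≡ inv c + e
    inversions c (len , c≤k) =
      trans (inv-insertAt₂-top k i (suc j) c c≤k i<j (≤-suc-length k c len j≤n))
            (trans (+-assoc (inv c) i j) (cong (inv c +_) (sym e≡)))

  𝔠-expand-last-column : ∀ d → 𝔠 n lam d ≡ Σpairs (suc n) (λ i j → pairTerm i j d)
  𝔠-expand-last-column d = begin
    𝔠 n lam d
      ≡⟨ 𝔠-Σword n lam d ⟩
    Σword (2 * n) n (Dellac-with-inv d)
      ≡⟨ Σword-cong (2 * n) n (λ c _ → two-dots-in-last-column c) ⟩
    Σword-occ k 2 (2 * n) (Dellac-with-inv d)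
      ≡⟨ Σword-occ-2 k (2 * n) (Dellac-with-inv d) ⟩
    Σpairs (2 * n) (λ i j → Σword (2 * n ∸ 2) k (Dellac-with-inv d ∘ insertAt₂ n i j))
      ≡⟨ Σpairs-cong (2 * n) (λ i j _ _ → cong (λ m → Σword m k (Dellac-with-inv d ∘ insertAt₂ n i j)) (cong (_∸ 2) (2n≡ k))) ⟩
    Σpairs (2 * n) (λ i j → Σword (2 * k) k (Dellac-with-inv d ∘ insertAt₂ n i j))
      ≡⟨ Σpairs-truncate (suc n) (2 * n) (≤-trans (s≤s (s≤s (m≤m+n k (k + 0)))) (≤-reflexive (sym (2n≡ k)))) (λ i j _ n<j j<2n →
           Σword-zero (2 * k) k (λ c w → cong (λ b → boolToℕ (b ∧ (inv (insertAt₂ n i j c) ≡ᵇ d)))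
                                             (isDellac-insertAt₂-top-below k′ lam i j c w n<j j<2n))) ⟩
    Σpairs (suc n) (λ i j → Σword (2 * k) k (Dellac-with-inv d ∘ insertAt₂ n i j))
      ≡⟨ Σpairs-cong (suc n) (λ i j i<j j<n+1 → Σword-remove-last-column d i j i<j (≤-pred j<n+1)) ⟩
    Σpairs (suc n) (λ i j → pairTerm i j d)
      ∎
    where
    open ≡-Reasoning
    2n≡ : ∀ k → 2 * suc k ≡ 2 + 2 * k
    2n≡ = solve-∀
    two-dots-in-last-column : ∀ c → Dellac-with-inv d c ≡ (if occ n c ≡ᵇ 2 then Dellac-with-inv d c else 0)
    two-dots-in-last-column c with occ n c ≡ᵇ 2 in occ≡
    ... | true  = refl
    ... | false = cong (λ b → boolToℕ (b ∧ (inv c ≡ᵇ d))) (isDellac-occ-top k lam c occ≡)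

  𝔠-recurrence : 𝔠 n lam ≈P
    ΣP (concatMap (λ i → map (λ j → q^ (i + j ∸ 3) · 𝔠 k (delete2 n lam i j)) (range (i + 1) (n + 1))) (range 1 (n + 1)))
  𝔠-recurrence d = begin
    𝔠 n lam d                                 ≡⟨ 𝔠-expand-last-column d ⟩
    Σpairs (suc n) (λ i j → pairTerm i j d)   ≡⟨ cong (λ N → Σpairs N (λ i j → pairTerm i j d)) (+-comm 1 n) ⟩
    Σpairs (n + 1) (λ i j → pairTerm i j d)   ≡⟨ sym (ΣP-pairs (n + 1) (λ i j → q^ (i + j ∸ 3) · 𝔠 k (delete2 n lam i j)) d) ⟩
    _                                         ∎
    where open ≡-Reasoning

  𝔠-recurrence-first-row-full : nth lam 0 ≡ k → 𝔠 n lam ≈P ΣP (map (λ i → q^ (i ∸ 2) · 𝔠 k (delete2 n lam 1 i)) (range 2 (n + 1)))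
  𝔠-recurrence-first-row-full λ₁≡k d = begin
    𝔠 n lam d                                 ≡⟨ 𝔠-expand-last-column d ⟩
    Σpairs (suc n) (λ i j → pairTerm i j d)   ≡⟨ Σpairs-first-row n (λ i j → pairTerm i j d) only-first-row ⟩
    Σ< n (λ j → pairTerm 0 (suc j) d)         ≡⟨ Σ<-cong′ {f = λ j → pairTerm 0 (suc j) d} (sym (m+n∸n≡m n 1)) (λ _ → refl) ⟩
    Σ< (n + 1 ∸ 1) (λ j → pairTerm 0 (suc j) d)
      ≡⟨ sym (ΣP-range 2 (n + 1) (λ i → q^ (i ∸ 2) · 𝔠 k (delete2 n lam 1 i)) d) ⟩
    ΣP (map (λ i → q^ (i ∸ 2) · 𝔠 k (delete2 n lam 1 i)) (range 2 (n + 1))) d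
      ∎
    where
    open ≡-Reasoning
    only-first-row : ∀ i j → suc i < j → pairTerm (suc i) j d ≡ 0
    only-first-row i (suc j) i<j = q^·-zeroP (suc (suc i) + suc (suc j) ∸ 3) (𝔠-first-row-full k′ lam′ row1-full) d
      where
      lam′ = delete2 n lam (suc (suc i)) (suc (suc j))
      row1-full : k ≤ nth lam′ 0
      row1-full = ≤-reflexive (trans (sym λ₁≡k) (sym (nth-delete2 n lam (suc i) (suc j) i<j length-lam 0)))

nth≤head : ∀ xs → Linked _≥_ xs → ∀ r → nth xs r ≤ nth xs 0
nth≤head []           _                 r       = z≤n
nth≤head (x ∷ [])     _                 zero    = ≤-refl
nth≤head (x ∷ [])     _                 (suc r) = z≤n
nth≤head (x ∷ y ∷ xs) _                 zero    = ≤-refl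
nth≤head (x ∷ y ∷ xs) (x≥y ∷ decreasing) (suc r) = ≤-trans (nth≤head (y ∷ xs) decreasing r) x≥y

proposition7p9 : (n : ℕ) → 2 ≤ n → (lam : List ℕ) →
    All (λ x → 1 ≤ x) lam → Linked _≥_ lam →
    length lam ≤ n ∸ 1 → (∀ m → occ m lam ≤ 2) → entry lam 1 ≤ n ∸ 1 →
    (entry lam 1 ≡ n ∸ 1 →
      𝔠 n lam ≈P ΣP (map (λ i → q^ (i ∸ 2) · 𝔠 (n ∸ 1) (delete2 n lam 1 i)) (range 2 (n + 1))))
    ×
    (entry lam 1 ≤ n ∸ 2 →
      𝔠 n lam ≈P ΣP (concatMap (λ i → map (λ j → q^ (i + j ∸ 3) · 𝔠 (n ∸ 1) (delete2 n lam i j))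
                                        (range (i + 1) (n + 1)))
                             (range 1 (n + 1))))
proposition7p9 (suc (suc k′)) (s≤s (s≤s z≤n)) lam _ decreasing length≤ _ λ₁≤ =
  (λ λ₁≡ → 𝔠-recurrence-first-row-full k′ lam lam<n length-lam (trans (sym (entry-suc lam 0)) λ₁≡)) ,
  (λ _ → 𝔠-recurrence k′ lam lam<n length-lam)
  where
  lam<n : ∀ r → nth lam r < suc (suc k′)
  lam<n r = s≤s (≤-trans (nth≤head lam decreasing r) (subst (_≤ suc k′) (entry-suc lam 0) λ₁≤))
  length-lam : length lam ≤ suc (suc (suc k′))
  length-lam = ≤-trans length≤ (≤-trans (n≤1+n _) (n≤1+n _))
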